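{- Let $\alpha\in[0,1]$. Suppose there exist three distinct indices $i,j,k$ such that, for $T=\{\pi_i,\pi_j,\pi_k\}$, $|I_r\cap I_s|\le\alpha\,\mathrm{AVG}$ for all $r\ne s\in\{i,j,k\}$. Let $G_T$ be the unweighted tournament on $[d]$ containing the arc $(a,b)$ iff $a$ precedes $b$ in at least two of $\pi_i,\pi_j,\pi_k$; let $E'$ be any feedback arc set of $G_T$ (a set of arcs whose removal makes $G_T$ acyclic) of size at most $1.00001$ times the minimum size of a feedback arc set of $G_T$; let $\tilde\pi_T$ be a topological ordering of $G_T$ with the arcs of $E'$ removed; and let $\tilde\sigma_T\in\mathcal{F}$ be a closest fair ranking to $\tilde\pi_T$. Then $\mathrm{Obj}(\tilde\sigma_T)\le(1+12.0001\alpha)\mathrm{OPT}$.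
   Context: $\mathbb{S}_d$ is the set of rankings of $[d]$; $a\prec_\pi b$ means $a$ precedes $b$ in $\pi$; Kendall tau distance $\kappa(\pi,\sigma)=|\{(a,b): a\prec_\pi b,\ b\prec_\sigma a\}|$. Fix a nonempty set $\mathcal{F}\subseteq\mathbb{S}_d$ of rankings called fair; a closest fair ranking to $\pi$ is an element of $\mathcal{F}$ minimizing $\kappa(\pi,\cdot)$. Let $S=\{\pi_1,\dots,\pi_n\}$ be the input list of $n$ rankings, $\mathrm{Obj}(\sigma)=\sum_{j=1}^n\kappa(\sigma,\pi_j)$, $\sigma^*\in\mathcal{F}$ a minimizer of $\mathrm{Obj}$ over $\mathcal{F}$, $\mathrm{OPT}=\mathrm{Obj}(\sigma^*)$, $\mathrm{AVG}=\mathrm{OPT}/n$, and $I_i=\{(a,b): a\prec_{\pi_i}b,\ b\prec_{\sigma^*}a\}$ for each $i$. -}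

module Defs where

open import Data.Nat using (ℕ; _≤_)
open import Data.Bool using (Bool; true; false; if_then_else_; _∧_; _∨_)
open import Data.Fin using (Fin; _<_; _<?_)
open import Data.Fin.Permutation using (Permutation′; _⟨$⟩ʳ_)
open import Data.List using (List; map; allFin)
open import Data.Nat.ListAction using (sum)
open import Data.Product using (_×_)
open import Data.Integer using (+_)
open import Data.Rational using (ℚ; _/_)
open import Relation.Nullary using (¬_)
open import Relation.Nullary.Decidable using (⌊_⌋)
open import Relation.Binary.PropositionalEquality using (_≡_)
open import Relation.Binary.Construct.Closure.Transitive using (TransClosure)

-- A ranking of [d] = {0,…,d-1}: a permutation sending each item to its position.
Ranking : ℕ → Set
Ranking d = Permutation′ d

_≺[_]_ : ∀ {d} → Fin d → Ranking d → Fin d → Set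
a ≺[ π ] b = (π ⟨$⟩ʳ a) < (π ⟨$⟩ʳ b)

precᵇ : ∀ {d} → Ranking d → Fin d → Fin d → Bool
precᵇ π a b = ⌊ (π ⟨$⟩ʳ a) <? (π ⟨$⟩ʳ b) ⌋

countPairs : ∀ {d} → (Fin d → Fin d → Bool) → ℕ
countPairs {d} P =
  sum (map (λ a → sum (map (λ b → if P a b then 1 else 0) (allFin d))) (allFin d))

κ : ∀ {d} → Ranking d → Ranking d → ℕ
κ π σ = countPairs (λ a b → precᵇ π a b ∧ precᵇ σ b a)

Obj : ∀ {d n} → (Fin n → Ranking d) → Ranking d → ℕ
Obj {n = n} S σ = sum (map (λ j → κ σ (S j)) (allFin n))

interSize : ∀ {d n} → (Fin n → Ranking d) → Ranking d → Fin n → Fin n → ℕ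
interSize S σ* r s =
  countPairs (λ a b → (precᵇ (S r) a b ∧ precᵇ σ* b a) ∧ (precᵇ (S s) a b ∧ precᵇ σ* b a))

IsClosestFair : ∀ {d} → (Ranking d → Set) → Ranking d → Ranking d → Set
IsClosestFair F π σ = F σ × (∀ τ → F τ → κ π σ ≤ κ π τ)

IsFairOptimum : ∀ {d n} → (Ranking d → Set) → (Fin n → Ranking d) → Ranking d → Set
IsFairOptimum F S σ = F σ × (∀ τ → F τ → Obj S σ ≤ Obj S τ)

majᵇ : Bool → Bool → Bool → Bool
majᵇ x y z = (x ∧ y) ∨ (y ∧ z) ∨ (x ∧ z)

Arc : ∀ {d} → Ranking d → Ranking d → Ranking d → Fin d → Fin d → Set
Arc p q r a b = majᵇ (precᵇ p a b) (precᵇ q a b) (precᵇ r a b) ≡ true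

ArcSet : ℕ → Set
ArcSet d = Fin d → Fin d → Bool

size : ∀ {d} → ArcSet d → ℕ
size E = countPairs E

Remove : ∀ {d} → (Fin d → Fin d → Set) → ArcSet d → Fin d → Fin d → Set
Remove G E a b = G a b × (E a b ≡ false)

Acyclic : ∀ {d} → (Fin d → Fin d → Set) → Set
Acyclic {d} G = (a : Fin d) → ¬ TransClosure G a a

IsFAS : ∀ {d} → (Fin d → Fin d → Set) → ArcSet d → Set
IsFAS G E = (∀ a b → E a b ≡ true → G a b) × Acyclic (Remove G E)

IsTopOrder : ∀ {d} → (Fin d → Fin d → Set) → Ranking d → Set
IsTopOrder G τ = ∀ a b → G a b → a ≺[ τ ] b

ℕ→ℚ : ℕ → ℚ
ℕ→ℚ m = (+ m) / 1

c1·00001 : ℚ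
c1·00001 = (+ 100001) / 100000

c12·0001 : ℚ
c12·0001 = (+ 120001) / 10000

-- Let B be the set of arcs of the majority tournament G_T of π_i, π_j, π_k that σ* reverses.
-- Deleting B leaves only arcs that agree with σ*, so B is a feedback arc set and
-- |E′| ≤ 1.00001 |B|. A pair inverted between π~ and σ* is either an arc of B or the
-- reverse of an arc of E′ (π~ orders all other arcs of G_T correctly), so
-- κ(π~, σ*) ≤ |E′| + |B|. An arc of B agrees with two of the three rankings and is
-- reversed by σ*, hence lies in two of I_i, I_j, I_k; so |B| ≤ Σ |I_r ∩ I_s| ≤ 3α·AVG.
-- As σ~ is a closest fair ranking to π~ and σ* is fair, κ(σ~, σ*) ≤ 2 κ(π~, σ*), and the
-- triangle inequality gives Obj(σ~) ≤ n κ(σ~, σ*) + OPT ≤ (1 + 2 · 2.00001 · 3 α) OPT,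
-- and 2 · 2.00001 · 3 = 12.00006 ≤ 12.0001.

module Submission where

open import Defs
open import Data.Bool using (Bool; true; false; if_then_else_; _∧_; _∨_; not)
open import Data.Bool.Properties using (∧-comm; ∨-zeroʳ)
open import Data.Empty using (⊥-elim)
open import Data.Fin using (Fin; _<?_)
import Data.Fin.Properties as Fin
open import Data.Fin.Permutation using (_⟨$⟩ʳ_)
open import Data.Integer as ℤ using (+_; +≤+; 1ℤ)
import Data.Integer.Properties as ℤ
open import Data.List using (List; []; _∷_; map; allFin; length)
open import Data.List.Properties using (map-cong; length-tabulate)
open import Data.Nat using (ℕ; z≤n; s≤s)
  renaming (_≤_ to _≤ℕ_; _+_ to _+ℕ_; _*_ to _*ℕ_)
import Data.Nat.Coprimality as Coprime
open import Data.Nat.ListAction using (sum)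
import Data.Nat.Properties as ℕ
open import Algebra.Properties.CommutativeSemigroup ℕ.+-commutativeSemigroup using (interchange)
open import Data.Product using (_×_; _,_; proj₁)
open import Data.Rational using (ℚ; 0ℚ; 1ℚ; _+_; _*_; _≤_; toℚᵘ; nonNegative; NonNegative)
import Data.Rational.Properties as ℚ
open import Data.Rational.Solver using (module +-*-Solver)
open import Data.Rational.Unnormalised as ℚᵘ using (mkℚᵘ; *≡*; *≤*)
import Data.Rational.Unnormalised.Properties as ℚᵘ
open import Data.Sum using (_⊎_; inj₁; inj₂)
open import Function using (flip; id; _∘_)
open import Function.Bundles using (Injection)
open import Function.Properties.Inverse using (↔⇒↣)
open import Relation.Binary using (tri<; tri≈; tri>)
open import Relation.Binary.Construct.Closure.Transitive using (TransClosure; [_]; _∷_)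
open import Relation.Binary.PropositionalEquality
  using (_≡_; _≢_; refl; sym; trans; cong; cong₂; subst; subst₂; module ≡-Reasoning)
open import Relation.Nullary using (¬_; yes; no)
open import Relation.Nullary.Decidable using (dec-true; dec-false; isYes≗does; toWitness)

𝟙 : Bool → ℕ
𝟙 b = if b then 1 else 0

∧≡true⇒ : ∀ {x y} → x ∧ y ≡ true → x ≡ true × y ≡ true
∧≡true⇒ {true} {true} refl = refl , refl

true∧y≡false⇒ : ∀ {x y} → x ≡ true → x ∧ y ≡ false → y ≡ false
true∧y≡false⇒ refl y≡false = y≡false

module _ {A : Set} where

  sum-map-mono-≤ : ∀ {f g : A → ℕ} → (∀ x → f x ≤ℕ g x) →
                   ∀ xs → sum (map f xs) ≤ℕ sum (map g xs)
  sum-map-mono-≤ f≤g []       = z≤n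
  sum-map-mono-≤ f≤g (x ∷ xs) = ℕ.+-mono-≤ (f≤g x) (sum-map-mono-≤ f≤g xs)

  sum-map-+ : ∀ (f g : A → ℕ) xs →
              sum (map (λ x → f x +ℕ g x) xs) ≡ sum (map f xs) +ℕ sum (map g xs)
  sum-map-+ f g []       = refl
  sum-map-+ f g (x ∷ xs) = begin
    (f x +ℕ g x) +ℕ sum (map (λ x → f x +ℕ g x) xs)
      ≡⟨ cong ((f x +ℕ g x) +ℕ_) (sum-map-+ f g xs) ⟩
    (f x +ℕ g x) +ℕ (sum (map f xs) +ℕ sum (map g xs))
      ≡⟨ interchange (f x) (g x) _ _ ⟩
    (f x +ℕ sum (map f xs)) +ℕ (g x +ℕ sum (map g xs)) ∎
    where open ≡-Reasoning

  sum-map-const : ∀ c (xs : List A) → sum (map (λ _ → c) xs) ≡ length xs *ℕ c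
  sum-map-const c []       = refl
  sum-map-const c (x ∷ xs) = cong (c +ℕ_) (sum-map-const c xs)

sum-map-comm : ∀ {A B : Set} (f : A → B → ℕ) xs ys →
               sum (map (λ x → sum (map (f x) ys)) xs) ≡
               sum (map (λ y → sum (map (flip f y) xs)) ys)
sum-map-comm f []       ys = sym (trans (sum-map-const 0 ys) (ℕ.*-zeroʳ (length ys)))
sum-map-comm f (x ∷ xs) ys =
  trans (cong (sum (map (f x) ys) +ℕ_) (sum-map-comm f xs ys))
        (sym (sum-map-+ (f x) (λ y → sum (map (flip f y) xs)) ys))

module _ {d : ℕ} where

  Σ² : (Fin d → Fin d → ℕ) → ℕ
  Σ² f = sum (map (λ a → sum (map (f a) (allFin d))) (allFin d))

  Σ²-mono-≤ : ∀ {f g} → (∀ a b → f a b ≤ℕ g a b) → Σ² f ≤ℕ Σ² g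
  Σ²-mono-≤ f≤g = sum-map-mono-≤ (λ a → sum-map-mono-≤ (f≤g a) (allFin d)) (allFin d)

  Σ²-+ : ∀ f g → Σ² (λ a b → f a b +ℕ g a b) ≡ Σ² f +ℕ Σ² g
  Σ²-+ f g = trans (cong sum (map-cong (λ a → sum-map-+ (f a) (g a) (allFin d)) (allFin d)))
                   (sum-map-+ _ _ (allFin d))

  countPairs-mono : ∀ {P Q : Fin d → Fin d → Bool} →
                    (∀ a b → P a b ≡ true → Q a b ≡ true) → countPairs P ≤ℕ countPairs Q
  countPairs-mono {P} {Q} P⇒Q = Σ²-mono-≤ 𝟙-mono
    where
    𝟙-mono : ∀ a b → 𝟙 (P a b) ≤ℕ 𝟙 (Q a b)
    𝟙-mono a b with P a b | P⇒Q a b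
    ... | false | _  = z≤n
    ... | true  | PQ rewrite PQ refl = ℕ.≤-refl

  countPairs-∨ : ∀ (P Q : Fin d → Fin d → Bool) →
                 countPairs (λ a b → P a b ∨ Q a b) ≤ℕ countPairs P +ℕ countPairs Q
  countPairs-∨ P Q =
    ℕ.≤-trans (Σ²-mono-≤ (λ a b → 𝟙-∨ (P a b) (Q a b))) (ℕ.≤-reflexive (Σ²-+ _ _))
    where
    𝟙-∨ : ∀ x y → 𝟙 (x ∨ y) ≤ℕ 𝟙 x +ℕ 𝟙 y
    𝟙-∨ true  y = s≤s z≤n
    𝟙-∨ false y = ℕ.≤-refl

  countPairs-cong : ∀ {P Q : Fin d → Fin d → Bool} → (∀ a b → P a b ≡ Q a b) →
                    countPairs P ≡ countPairs Q
  countPairs-cong P≡Q = cong sum (map-cong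
    (λ a → cong sum (map-cong (λ b → cong 𝟙 (P≡Q a b)) (allFin d))) (allFin d))

  countPairs-transpose : ∀ (P : Fin d → Fin d → Bool) → countPairs P ≡ countPairs (flip P)
  countPairs-transpose P = sum-map-comm (λ a b → 𝟙 (P a b)) (allFin d) (allFin d)

module _ {d : ℕ} where

  precᵇ-sound : ∀ π {a b : Fin d} → precᵇ π a b ≡ true → a ≺[ π ] b
  precᵇ-sound π {a} {b} with (π ⟨$⟩ʳ a) <? (π ⟨$⟩ʳ b)
  ... | yes a≺b = λ _ → a≺b
  ... | no  _   = λ ()

  precᵇ-complete : ∀ π {a b : Fin d} → a ≺[ π ] b → precᵇ π a b ≡ true
  precᵇ-complete π {a} {b} a≺b =
    trans (isYes≗does _) (dec-true ((π ⟨$⟩ʳ a) <? (π ⟨$⟩ʳ b)) a≺b)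

  precᵇ-complete-¬ : ∀ π {a b : Fin d} → ¬ a ≺[ π ] b → precᵇ π a b ≡ false
  precᵇ-complete-¬ π {a} {b} a⊀b =
    trans (isYes≗does _) (dec-false ((π ⟨$⟩ʳ a) <? (π ⟨$⟩ʳ b)) a⊀b)

  precᵇ-irrefl : ∀ π (a : Fin d) → precᵇ π a a ≡ false
  precᵇ-irrefl π a = precᵇ-complete-¬ π (Fin.<-irrefl refl)

  precᵇ⇒≢ : ∀ π {a b : Fin d} → precᵇ π a b ≡ true → a ≢ b
  precᵇ⇒≢ π {a} h refl with trans (sym h) (precᵇ-irrefl π a)
  ... | ()

  precᵇ-flip : ∀ π {a b : Fin d} → a ≢ b → precᵇ π b a ≡ not (precᵇ π a b)
  precᵇ-flip π {a} {b} a≢b with Fin.<-cmp (π ⟨$⟩ʳ a) (π ⟨$⟩ʳ b)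
  ... | tri< a≺b _ b⊀a rewrite precᵇ-complete π a≺b | precᵇ-complete-¬ π b⊀a = refl
  ... | tri> a⊀b _ b≺a rewrite precᵇ-complete-¬ π a⊀b | precᵇ-complete π b≺a = refl
  ... | tri≈ _ πa≡πb _ = ⊥-elim (a≢b (Injection.injective (↔⇒↣ π) πa≡πb))

  inversions : Ranking d → Ranking d → Fin d → Fin d → Bool
  inversions π σ a b = precᵇ π a b ∧ precᵇ σ b a

  κ-sym : ∀ (π σ : Ranking d) → κ π σ ≡ κ σ π
  κ-sym π σ = trans (countPairs-transpose (inversions π σ))
                    (countPairs-cong (λ a b → ∧-comm (precᵇ π b a) (precᵇ σ a b)))

  κ-triangle : ∀ (π σ ρ : Ranking d) → κ π ρ ≤ℕ κ π σ +ℕ κ σ ρ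
  κ-triangle π σ ρ =
    ℕ.≤-trans (countPairs-mono through-σ) (countPairs-∨ (inversions π σ) (inversions σ ρ))
    where
    either-way : ∀ x t s y → x ≡ true → y ≡ true → t ≡ not s → (x ∧ t) ∨ (s ∧ y) ≡ true
    either-way _ _ true  _ refl refl refl = refl
    either-way _ _ false _ refl refl refl = refl

    through-σ : ∀ a b → inversions π ρ a b ≡ true →
                (inversions π σ a b ∨ inversions σ ρ a b) ≡ true
    through-σ a b h with ∧≡true⇒ h
    ... | πab , ρba = either-way (precᵇ π a b) (precᵇ σ b a) (precᵇ σ a b) (precᵇ ρ b a)
                                 πab ρba (precᵇ-flip σ (precᵇ⇒≢ π πab))

  Obj-triangle : ∀ {n} (S : Fin n → Ranking d) (σ τ : Ranking d) →
                 Obj S σ ≤ℕ n *ℕ κ σ τ +ℕ Obj S τ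
  Obj-triangle {n} S σ τ = begin
    Obj S σ
      ≤⟨ sum-map-mono-≤ (λ j → κ-triangle σ τ (S j)) (allFin n) ⟩
    sum (map (λ j → κ σ τ +ℕ κ τ (S j)) (allFin n))
      ≡⟨ sum-map-+ (λ _ → κ σ τ) (λ j → κ τ (S j)) (allFin n) ⟩
    sum (map (λ _ → κ σ τ) (allFin n)) +ℕ Obj S τ
      ≡⟨ cong (_+ℕ Obj S τ) (sum-map-const (κ σ τ) (allFin n)) ⟩
    length (allFin n) *ℕ κ σ τ +ℕ Obj S τ
      ≡⟨ cong (λ m → m *ℕ κ σ τ +ℕ Obj S τ) (length-tabulate {n = n} id) ⟩
    n *ℕ κ σ τ +ℕ Obj S τ ∎
    where open ℕ.≤-Reasoning

  closestFair-κ-≤ : ∀ {F : Ranking d → Set} π {σ τ} →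
                    IsClosestFair F π σ → F τ → κ σ τ ≤ℕ 2 *ℕ κ π τ
  closestFair-κ-≤ π {σ} {τ} (_ , closest) Fτ = begin
    κ σ τ                ≤⟨ κ-triangle σ π τ ⟩
    κ σ π +ℕ κ π τ       ≡⟨ cong (_+ℕ κ π τ) (κ-sym σ π) ⟩
    κ π σ +ℕ κ π τ       ≤⟨ ℕ.+-monoˡ-≤ (κ π τ) (closest τ Fτ) ⟩
    κ π τ +ℕ κ π τ       ≡⟨ cong (κ π τ +ℕ_) (sym (ℕ.+-identityʳ (κ π τ))) ⟩
    2 *ℕ κ π τ           ∎
    where open ℕ.≤-Reasoning

  closestFair-Obj-≤ : ∀ {n} {F : Ranking d → Set} (S : Fin n → Ranking d) π {σ τ} →
                      IsClosestFair F π σ → F τ → Obj S σ ≤ℕ n *ℕ (2 *ℕ κ π τ) +ℕ Obj S τ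
  closestFair-Obj-≤ {n} S π {σ} {τ} closest Fτ = ℕ.≤-trans (Obj-triangle S σ τ)
    (ℕ.+-monoˡ-≤ (Obj S τ) (ℕ.*-monoʳ-≤ n (closestFair-κ-≤ π closest Fτ)))

module _ {d : ℕ} where

  topOrder⇒acyclic : ∀ {G : Fin d → Fin d → Set} τ → IsTopOrder G τ → Acyclic G
  topOrder⇒acyclic {G} τ top a cycle = Fin.<-irrefl refl (ascending cycle)
    where
    ascending : ∀ {x y} → TransClosure G x y → x ≺[ τ ] y
    ascending [ g ]      = top _ _ g
    ascending (g ∷ walk) = Fin.<-trans (top _ _ g) (ascending walk)

  Graph : ArcSet d → Fin d → Fin d → Set
  Graph g a b = g a b ≡ true

  backArcs : ArcSet d → Ranking d → ArcSet d
  backArcs g σ a b = g a b ∧ precᵇ σ b a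

  backArcs-isFAS : ∀ {g} σ → (∀ a → g a a ≡ false) → IsFAS (Graph g) (backArcs g σ)
  backArcs-isFAS {g} σ irreflexive =
    (λ a b → proj₁ ∘ ∧≡true⇒ {g a b} {precᵇ σ b a}) , topOrder⇒acyclic σ forward
    where
    forward : IsTopOrder (Remove (Graph g) (backArcs g σ)) σ
    forward a b (gab , not-back) = precᵇ-sound σ (trans (precᵇ-flip σ b≢a) (cong not σba))
      where
      σba : precᵇ σ b a ≡ false
      σba = true∧y≡false⇒ gab not-back
      b≢a : b ≢ a
      b≢a refl with trans (sym gab) (irreflexive a)
      ... | ()

  topOrder-κ-≤ : ∀ g E π σ → (∀ {a b} → a ≢ b → g b a ≡ not (g a b)) →
                 IsTopOrder (Remove (Graph g) E) π → κ π σ ≤ℕ size E +ℕ size (backArcs g σ)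
  topOrder-κ-≤ g E π σ tournament top = begin
    κ π σ                                          ≤⟨ countPairs-mono cover ⟩
    countPairs (λ a b → E b a ∨ backArcs g σ a b)  ≤⟨ countPairs-∨ (flip E) (backArcs g σ) ⟩
    countPairs (flip E) +ℕ size (backArcs g σ)
      ≡⟨ cong (_+ℕ size (backArcs g σ)) (sym (countPairs-transpose E)) ⟩
    size E +ℕ size (backArcs g σ)                  ∎
    where
    open ℕ.≤-Reasoning
    cover : ∀ a b → inversions π σ a b ≡ true → (E b a ∨ backArcs g σ a b) ≡ true
    cover a b h with ∧≡true⇒ h
    ... | πab , σba with g a b in gab
    ...   | true  = subst (λ s → E b a ∨ s ≡ true) (sym σba) (∨-zeroʳ (E b a))
    ...   | false with E b a in Eba
    ...     | true  = refl
    ...     | false = ⊥-elim (Fin.<-asym (precᵇ-sound π πab) (top b a (gba , Eba)))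
      where
      gba : g b a ≡ true
      gba = trans (tournament (precᵇ⇒≢ π πab)) (cong not gab)

majᵇ-cong : ∀ {x x′ y y′ z z′} → x ≡ x′ → y ≡ y′ → z ≡ z′ → majᵇ x y z ≡ majᵇ x′ y′ z′
majᵇ-cong refl refl refl = refl

majᵇ-not : ∀ x y z → majᵇ (not x) (not y) (not z) ≡ not (majᵇ x y z)
majᵇ-not true  true  true  = refl
majᵇ-not true  true  false = refl
majᵇ-not true  false true  = refl
majᵇ-not true  false false = refl
majᵇ-not false true  true  = refl
majᵇ-not false true  false = refl
majᵇ-not false false true  = refl
majᵇ-not false false false = refl

majᵇ-∧-cover : ∀ x y z w → majᵇ x y z ∧ w ≡ true →
               ((x ∧ w) ∧ (y ∧ w)) ∨ (((y ∧ w) ∧ (z ∧ w)) ∨ ((x ∧ w) ∧ (z ∧ w))) ≡ true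
majᵇ-∧-cover true  true  _     true refl = refl
majᵇ-∧-cover true  false true  true refl = refl
majᵇ-∧-cover false true  true  true refl = refl
majᵇ-∧-cover true  false false _    ()
majᵇ-∧-cover false true  false _    ()
majᵇ-∧-cover false false _     _    ()

module _ {d : ℕ} where

  majority : Ranking d → Ranking d → Ranking d → ArcSet d
  majority p q r a b = majᵇ (precᵇ p a b) (precᵇ q a b) (precᵇ r a b)

  majority-irrefl : ∀ p q r (a : Fin d) → majority p q r a a ≡ false
  majority-irrefl p q r a = majᵇ-cong (precᵇ-irrefl p a) (precᵇ-irrefl q a) (precᵇ-irrefl r a)

  majority-flip : ∀ p q r {a b : Fin d} → a ≢ b → majority p q r b a ≡ not (majority p q r a b)
  majority-flip p q r {a} {b} a≢b =
    trans (majᵇ-cong (precᵇ-flip p a≢b) (precᵇ-flip q a≢b) (precᵇ-flip r a≢b))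
          (majᵇ-not (precᵇ p a b) (precᵇ q a b) (precᵇ r a b))

  backArcs-majority-≤ : ∀ p q r σ →
    size (backArcs (majority p q r) σ) ≤ℕ
      countPairs (λ a b → inversions p σ a b ∧ inversions q σ a b) +ℕ
      (countPairs (λ a b → inversions q σ a b ∧ inversions r σ a b) +ℕ
       countPairs (λ a b → inversions p σ a b ∧ inversions r σ a b))
  backArcs-majority-≤ p q r σ = begin
    size (backArcs (majority p q r) σ)
      ≤⟨ countPairs-mono (λ a b →
           majᵇ-∧-cover (precᵇ p a b) (precᵇ q a b) (precᵇ r a b) (precᵇ σ b a)) ⟩
    countPairs (λ a b → Ipq a b ∨ (Iqr a b ∨ Ipr a b))
      ≤⟨ countPairs-∨ Ipq _ ⟩
    countPairs Ipq +ℕ countPairs (λ a b → Iqr a b ∨ Ipr a b)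
      ≤⟨ ℕ.+-monoʳ-≤ (countPairs Ipq) (countPairs-∨ Iqr Ipr) ⟩
    countPairs Ipq +ℕ (countPairs Iqr +ℕ countPairs Ipr) ∎
    where
    open ℕ.≤-Reasoning
    Ipq Iqr Ipr : Fin d → Fin d → Bool
    Ipq a b = inversions p σ a b ∧ inversions q σ a b
    Iqr a b = inversions q σ a b ∧ inversions r σ a b
    Ipr a b = inversions p σ a b ∧ inversions r σ a b

toℚᵘ-ℕ→ℚ : ∀ m → toℚᵘ (ℕ→ℚ m) ≡ mkℚᵘ (+ m) 0
toℚᵘ-ℕ→ℚ m = cong toℚᵘ (ℚ.normalize-coprime (Coprime.sym (Coprime.1-coprimeTo m)))

ℕ→ℚ-+ : ∀ m n → ℕ→ℚ (m +ℕ n) ≡ ℕ→ℚ m + ℕ→ℚ n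
ℕ→ℚ-+ m n = ℚ.toℚᵘ-injective (begin
  toℚᵘ (ℕ→ℚ (m +ℕ n))             ≡⟨ toℚᵘ-ℕ→ℚ (m +ℕ n) ⟩
  mkℚᵘ (+ (m +ℕ n)) 0             ≈⟨ *≡* (cong (ℤ._* 1ℤ) (trans (ℤ.pos-+ m n)
                                       (sym (cong₂ ℤ._+_ (ℤ.*-identityʳ (+ m))
                                                          (ℤ.*-identityʳ (+ n)))))) ⟩
  mkℚᵘ (+ m) 0 ℚᵘ.+ mkℚᵘ (+ n) 0   ≡⟨ cong₂ ℚᵘ._+_ (toℚᵘ-ℕ→ℚ m) (toℚᵘ-ℕ→ℚ n) ⟨
  toℚᵘ (ℕ→ℚ m) ℚᵘ.+ toℚᵘ (ℕ→ℚ n)  ≈⟨ ℚ.toℚᵘ-homo-+ (ℕ→ℚ m) (ℕ→ℚ n) ⟨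
  toℚᵘ (ℕ→ℚ m + ℕ→ℚ n)            ∎)
  where open ℚᵘ.≃-Reasoning

ℕ→ℚ-* : ∀ m n → ℕ→ℚ (m *ℕ n) ≡ ℕ→ℚ m * ℕ→ℚ n
ℕ→ℚ-* m n = ℚ.toℚᵘ-injective (begin
  toℚᵘ (ℕ→ℚ (m *ℕ n))             ≡⟨ toℚᵘ-ℕ→ℚ (m *ℕ n) ⟩
  mkℚᵘ (+ (m *ℕ n)) 0             ≈⟨ *≡* (cong (ℤ._* 1ℤ) (ℤ.pos-* m n)) ⟩
  mkℚᵘ (+ m) 0 ℚᵘ.* mkℚᵘ (+ n) 0   ≡⟨ cong₂ ℚᵘ._*_ (toℚᵘ-ℕ→ℚ m) (toℚᵘ-ℕ→ℚ n) ⟨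
  toℚᵘ (ℕ→ℚ m) ℚᵘ.* toℚᵘ (ℕ→ℚ n)  ≈⟨ ℚ.toℚᵘ-homo-* (ℕ→ℚ m) (ℕ→ℚ n) ⟨
  toℚᵘ (ℕ→ℚ m * ℕ→ℚ n)            ∎)
  where open ℚᵘ.≃-Reasoning

ℕ→ℚ-mono-≤ : ∀ {m n} → m ≤ℕ n → ℕ→ℚ m ≤ ℕ→ℚ n
ℕ→ℚ-mono-≤ {m} {n} m≤n = ℚ.toℚᵘ-cancel-≤
  (subst₂ ℚᵘ._≤_ (sym (toℚᵘ-ℕ→ℚ m)) (sym (toℚᵘ-ℕ→ℚ n)) (*≤* (ℤ.*-monoʳ-≤-nonNeg 1ℤ (+≤+ m≤n))))

ℕ→ℚ-nonNeg : ∀ m → 0ℚ ≤ ℕ→ℚ m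
ℕ→ℚ-nonNeg m = ℕ→ℚ-mono-≤ {0} {m} z≤n

approximation-bound-ℚ : ∀ (N o x b i₁ i₂ i₃ α : ℚ) → 0ℚ ≤ N → 0ℚ ≤ α → 0ℚ ≤ o →
  x ≤ c1·00001 * b → b ≤ i₁ + (i₂ + i₃) →
  N * i₁ ≤ α * o → N * i₂ ≤ α * o → N * i₃ ≤ α * o →
  N * (ℕ→ℚ 2 * (x + b)) + o ≤ (1ℚ + c12·0001 * α) * o
approximation-bound-ℚ N o x b i₁ i₂ i₃ α 0≤N 0≤α 0≤o x≤cb b≤Σi Ni₁≤αo Ni₂≤αo Ni₃≤αo = begin
  N * (2ℚ * (x + b)) + o                ≤⟨ ℚ.+-monoˡ-≤ o (*-monoˡ-N
                                             (ℚ.*-monoˡ-≤-nonNeg 2ℚ (ℚ.+-monoˡ-≤ b x≤cb))) ⟩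
  N * (2ℚ * (c * b + b)) + o            ≡⟨ cong (_+ o) (regroup N b) ⟩
  K * (N * b) + o                       ≤⟨ ℚ.+-monoˡ-≤ o (ℚ.*-monoˡ-≤-nonNeg K (*-monoˡ-N b≤Σi)) ⟩
  K * (N * (i₁ + (i₂ + i₃))) + o        ≡⟨ cong (λ t → K * t + o) (distrib N i₁ i₂ i₃) ⟩
  K * (N * i₁ + (N * i₂ + N * i₃)) + o  ≤⟨ ℚ.+-monoˡ-≤ o (ℚ.*-monoˡ-≤-nonNeg K
                                             (ℚ.+-mono-≤ Ni₁≤αo (ℚ.+-mono-≤ Ni₂≤αo Ni₃≤αo))) ⟩
  K * (α * o + (α * o + α * o)) + o     ≡⟨ cong (_+ o) (triple (α * o)) ⟩
  (K * 3ℚ) * (α * o) + o                ≤⟨ ℚ.+-monoˡ-≤ o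
                                             (ℚ.*-monoʳ-≤-nonNeg (α * o) {{αo≥0}} K*3≤c12) ⟩
  c12·0001 * (α * o) + o                ≡⟨ factor α o ⟩
  (1ℚ + c12·0001 * α) * o               ∎
  where
  open ℚ.≤-Reasoning
  open +-*-Solver
  c 2ℚ 3ℚ K : ℚ
  c  = c1·00001
  2ℚ = ℕ→ℚ 2
  3ℚ = ℕ→ℚ 3
  K  = 2ℚ * (c + 1ℚ)

  *-monoˡ-N : ∀ {p q} → p ≤ q → N * p ≤ N * q
  *-monoˡ-N = ℚ.*-monoˡ-≤-nonNeg N {{nonNegative 0≤N}}

  αo≥0 : NonNegative (α * o)
  αo≥0 = ℚ.nonNeg*nonNeg⇒nonNeg α {{nonNegative 0≤α}} o {{nonNegative 0≤o}}

  K*3≤c12 : K * 3ℚ ≤ c12·0001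
  K*3≤c12 = toWitness {a? = K * 3ℚ ℚ.≤? c12·0001} _

  regroup : ∀ N b → N * (2ℚ * (c * b + b)) ≡ K * (N * b)
  regroup = solve 2 (λ N b → N :* (con 2ℚ :* (con c :* b :+ b)) := con K :* (N :* b)) refl

  distrib : ∀ N i₁ i₂ i₃ → N * (i₁ + (i₂ + i₃)) ≡ N * i₁ + (N * i₂ + N * i₃)
  distrib = solve 4 (λ N i₁ i₂ i₃ → N :* (i₁ :+ (i₂ :+ i₃)) := N :* i₁ :+ (N :* i₂ :+ N :* i₃)) refl

  triple : ∀ t → K * (t + (t + t)) ≡ (K * 3ℚ) * t
  triple = solve 1 (λ t → con K :* (t :+ (t :+ t)) := (con K :* con 3ℚ) :* t) refl

  factor : ∀ α o → c12·0001 * (α * o) + o ≡ (1ℚ + c12·0001 * α) * o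
  factor = solve 2 (λ α o → con c12·0001 :* (α :* o) :+ o
                           := (con 1ℚ :+ con c12·0001 :* α) :* o) refl

approximation-bound : ∀ (n o x b i₁ i₂ i₃ : ℕ) α → 0ℚ ≤ α →
  ℕ→ℚ x ≤ c1·00001 * ℕ→ℚ b → b ≤ℕ i₁ +ℕ (i₂ +ℕ i₃) →
  ℕ→ℚ n * ℕ→ℚ i₁ ≤ α * ℕ→ℚ o → ℕ→ℚ n * ℕ→ℚ i₂ ≤ α * ℕ→ℚ o → ℕ→ℚ n * ℕ→ℚ i₃ ≤ α * ℕ→ℚ o →
  ℕ→ℚ (n *ℕ (2 *ℕ (x +ℕ b)) +ℕ o) ≤ (1ℚ + c12·0001 * α) * ℕ→ℚ o
approximation-bound n o x b i₁ i₂ i₃ α 0≤α x≤cb b≤Σi Ni₁≤αo Ni₂≤αo Ni₃≤αo = begin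
  ℕ→ℚ (n *ℕ (2 *ℕ (x +ℕ b)) +ℕ o)
    ≡⟨ ℕ→ℚ-+ (n *ℕ (2 *ℕ (x +ℕ b))) o ⟩
  ℕ→ℚ (n *ℕ (2 *ℕ (x +ℕ b))) + ℕ→ℚ o
    ≡⟨ cong (_+ ℕ→ℚ o) (ℕ→ℚ-* n (2 *ℕ (x +ℕ b))) ⟩
  ℕ→ℚ n * ℕ→ℚ (2 *ℕ (x +ℕ b)) + ℕ→ℚ o
    ≡⟨ cong (λ t → ℕ→ℚ n * t + ℕ→ℚ o) (ℕ→ℚ-* 2 (x +ℕ b)) ⟩
  ℕ→ℚ n * (ℕ→ℚ 2 * ℕ→ℚ (x +ℕ b)) + ℕ→ℚ o
    ≡⟨ cong (λ t → ℕ→ℚ n * (ℕ→ℚ 2 * t) + ℕ→ℚ o) (ℕ→ℚ-+ x b) ⟩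
  ℕ→ℚ n * (ℕ→ℚ 2 * (ℕ→ℚ x + ℕ→ℚ b)) + ℕ→ℚ o
    ≤⟨ approximation-bound-ℚ (ℕ→ℚ n) (ℕ→ℚ o) (ℕ→ℚ x) (ℕ→ℚ b) (ℕ→ℚ i₁) (ℕ→ℚ i₂) (ℕ→ℚ i₃) α
         (ℕ→ℚ-nonNeg n) 0≤α (ℕ→ℚ-nonNeg o) x≤cb b≤Σiℚ Ni₁≤αo Ni₂≤αo Ni₃≤αo ⟩
  (1ℚ + c12·0001 * α) * ℕ→ℚ o ∎
  where
  open ℚ.≤-Reasoning
  b≤Σiℚ : ℕ→ℚ b ≤ ℕ→ℚ i₁ + (ℕ→ℚ i₂ + ℕ→ℚ i₃)
  b≤Σiℚ = subst (ℕ→ℚ b ≤_) (trans (ℕ→ℚ-+ i₁ (i₂ +ℕ i₃)) (cong (λ q → ℕ→ℚ i₁ + q) (ℕ→ℚ-+ i₂ i₃)))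
                (ℕ→ℚ-mono-≤ b≤Σi)

lemma3 : {d n : ℕ} (F : Ranking d → Set) (S : Fin n → Ranking d)
         (σ* : Ranking d) → IsFairOptimum F S σ* →
         (α : ℚ) → 0ℚ ≤ α → α ≤ 1ℚ →
         (i j k : Fin n) → i ≢ j → j ≢ k → i ≢ k →
         (∀ r s → (r ≡ i ⊎ r ≡ j ⊎ r ≡ k) → (s ≡ i ⊎ s ≡ j ⊎ s ≡ k) → r ≢ s →
            ℕ→ℚ n * ℕ→ℚ (interSize S σ* r s) ≤ α * ℕ→ℚ (Obj S σ*)) →
         (E′ : ArcSet d) → IsFAS (Arc (S i) (S j) (S k)) E′ →
         (∀ E → IsFAS (Arc (S i) (S j) (S k)) E → ℕ→ℚ (size E′) ≤ c1·00001 * ℕ→ℚ (size E)) →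
         (π~ : Ranking d) → IsTopOrder (Remove (Arc (S i) (S j) (S k)) E′) π~ →
         (σ~ : Ranking d) → IsClosestFair F π~ σ~ →
         ℕ→ℚ (Obj S σ~) ≤ (1ℚ + c12·0001 * α) * ℕ→ℚ (Obj S σ*)
lemma3 {n = n} F S σ* (Fσ* , _) α 0≤α _ i j k i≢j j≢k i≢k small-overlap E′ _ E′-near-minimal
       π~ π~-top σ~ σ~-closest =
  ℚ.≤-trans (ℕ→ℚ-mono-≤ Obj-bound)
    (approximation-bound n (Obj S σ*) (size E′) (size B)
       (interSize S σ* i j) (interSize S σ* j k) (interSize S σ* i k) α 0≤α
       (E′-near-minimal B (backArcs-isFAS σ* (majority-irrefl (S i) (S j) (S k))))
       (backArcs-majority-≤ (S i) (S j) (S k) σ*)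
       (small-overlap i j (inj₁ refl) (inj₂ (inj₁ refl)) i≢j)
       (small-overlap j k (inj₂ (inj₁ refl)) (inj₂ (inj₂ refl)) j≢k)
       (small-overlap i k (inj₁ refl) (inj₂ (inj₂ refl)) i≢k))
  where
  G : ArcSet _
  G = majority (S i) (S j) (S k)

  B : ArcSet _
  B = backArcs G σ*

  Obj-bound : Obj S σ~ ≤ℕ n *ℕ (2 *ℕ (size E′ +ℕ size B)) +ℕ Obj S σ*
  Obj-bound = ℕ.≤-trans (closestFair-Obj-≤ S π~ σ~-closest Fσ*)
    (ℕ.+-monoˡ-≤ (Obj S σ*) (ℕ.*-monoʳ-≤ n (ℕ.*-monoʳ-≤ 2
      (topOrder-κ-≤ G E′ π~ σ* (majority-flip (S i) (S j) (S k)) π~-top))))
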